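{- Let $n\ge 2$. The $\varpi$-ruler sequence $E_n=(e_n(0),e_n(1),\ldots,e_n(n!-2))$ is a palindrome, i.e. $e_n(\alpha)=e_n(n!-2-\alpha)$ for all $\alpha\in\{0,\ldots,n!-2\}$.
   Context: Let $\varpi_{n,0}=1$ and $\varpi_{n,i}=n(n-1)\cdots(n-i+1)$ for $1\le i\le n-2$. Every integer $\alpha\in\{0,\ldots,n!-1\}$ is uniquely $\alpha=\sum_{i=0}^{n-2}\alpha_i\varpi_{n,i}$ with digits $\alpha_i\in\{0,\ldots,n-i-1\}$. For $\alpha\in\{0,\ldots,n!-2\}$ (so that not all digits satisfy $\alpha_i=n-i-1$), let $k$ be the largest integer in $\{0,\ldots,n-2\}$ such that $\alpha_i=n-i-1$ for all $i=0,\ldots,k-1$, and define the weight $e_n(\alpha)=k+1$. (Interpretation: with $\mathcal{S}_n=(p_0,\ldots,p_{n!-1})$ the permutations of $x_1,\ldots,x_n$ ordered by generation by cyclic shift, $e_n(\alpha)$ is the number of symbols erased on the left of $p_\alpha$ so that its remaining last symbols match the first symbols of $p_{\alpha+1}$, in the decomposition $p_\alpha=\overline{A}B$, $p_{\alpha+1}=BA$, $|A|=e_n(\alpha)$.) -}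

module Defs where

open import Data.Nat using (ℕ; zero; suc; _+_; _*_; _∸_; _≟_)
open import Data.Nat.DivMod using (_/_; _%_)
open import Relation.Nullary using (yes; no)

ϖ : ℕ → ℕ → ℕ
ϖ n zero    = 1
ϖ n (suc i) = ϖ n i * (n ∸ i)

-- ϖ n i is nonzero whenever i ≤ n; we avoid instance issues by
-- dividing by a safe quotient that returns 0 when the divisor is 0.
_div_ : ℕ → ℕ → ℕ
a div zero    = 0
a div (suc d) = a / suc d

_mod_ : ℕ → ℕ → ℕ
a mod zero    = a
a mod (suc d) = a % suc d

digit : ℕ → ℕ → ℕ → ℕ
digit n α i = (α div ϖ n i) mod (n ∸ i)

leading : ℕ → ℕ → ℕ → ℕ → ℕ
leading n α i zero    = 0
leading n α i (suc m) with digit n α i ≟ (n ∸ i ∸ 1)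
... | yes _ = suc (leading n α (suc i) m)
... | no  _ = 0

-- e n α = k + 1 where k is the largest integer in {0,…,n-2} such that
-- α_i = n-i-1 for all i < k.
e : ℕ → ℕ → ℕ
e n α = suc (leading n α 0 (n ∸ 2))

-- If ϖ_{n,i} divides α+1, then α_i = n-i-1 exactly when ϖ_{n,i+1} = ϖ_{n,i}(n-i) divides
-- α+1, so e_n(α) - 1 is the largest k ≤ n-2 such that ϖ_{n,k} divides α+1.
-- Every ϖ_{n,k} divides n! = (α+1) + ((n!-2-α)+1), so α+1 and (n!-2-α)+1 have the same
-- divisors among the ϖ_{n,k}, and hence the same weight.
module Submission where

open import Defs
open import Data.Nat using (ℕ; _∸_; _≤_)
open import Data.Nat using (_!)
open import Relation.Binary.PropositionalEquality using (_≡_)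

open import Data.Nat using (zero; suc; _+_; _*_; _<_; _/_; _%_; _≟_; NonZero; s≤s)
open import Data.Nat.Properties
open import Data.Nat.Divisibility
open import Data.Nat.DivMod using (m≡m%n+[m/n]*n; %-pred-≡0)
open import Data.Empty using (⊥-elim)
open import Function.Bundles using (_⇔_; mk⇔; Equivalence)
open import Relation.Nullary using (yes; no)
open import Relation.Binary.PropositionalEquality
  using (refl; sym; trans; cong; subst; module ≡-Reasoning)

open Equivalence using (to; from)

∣m+n⇒∣m⇔∣n : ∀ {d m n} → d ∣ m + n → d ∣ m ⇔ d ∣ n
∣m+n⇒∣m⇔∣n {d} {m} {n} d∣m+n = mk⇔ (∣m+n∣m⇒∣n d∣m+n)
  (∣m+n∣m⇒∣n (subst (d ∣_) (+-comm m n) d∣m+n))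

m%n≡n∸1⇒1+m≡[1+m/n]*n : ∀ m n .{{_ : NonZero n}} → m % n ≡ n ∸ 1 → suc m ≡ suc (m / n) * n
m%n≡n∸1⇒1+m≡[1+m/n]*n m n@(suc _) m%n≡n∸1 = begin
  suc m                     ≡⟨ cong suc (m≡m%n+[m/n]*n m n) ⟩
  suc (m % n + m / n * n)   ≡⟨ cong (λ r → suc r + m / n * n) m%n≡n∸1 ⟩
  suc (m / n) * n           ∎
  where open ≡-Reasoning

m%n≡n∸1⇔n∣1+m : ∀ m n .{{_ : NonZero n}} → m % n ≡ n ∸ 1 ⇔ n ∣ suc m
m%n≡n∸1⇔n∣1+m m n = mk⇔
  (λ m%n≡n∸1 → divides (suc (m / n)) (m%n≡n∸1⇒1+m≡[1+m/n]*n m n m%n≡n∸1))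
  (λ n∣1+m → %-pred-≡0 (n∣m⇒m%n≡0 (suc m) n n∣1+m))

[m/n]%o≡o∸1⇔n*o∣1+m : ∀ m n o .{{_ : NonZero n}} .{{_ : NonZero o}} → n ∣ suc m →
                       (m / n) % o ≡ o ∸ 1 ⇔ n * o ∣ suc m
[m/n]%o≡o∸1⇔n*o∣1+m m n o n∣1+m = mk⇔
  (λ eq → subst (n * o ∣_) (sym 1+m≡n*[1+m/n])
    (*-monoʳ-∣ n (to (m%n≡n∸1⇔n∣1+m (m / n) o) eq)))
  (λ n*o∣1+m → from (m%n≡n∸1⇔n∣1+m (m / n) o)
    (*-cancelˡ-∣ n (subst (n * o ∣_) 1+m≡n*[1+m/n] n*o∣1+m)))
  where
  1+m≡n*[1+m/n] : suc m ≡ n * suc (m / n)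
  1+m≡n*[1+m/n] = trans
    (m%n≡n∸1⇒1+m≡[1+m/n]*n m n (from (m%n≡n∸1⇔n∣1+m m n) n∣1+m))
    (*-comm (suc (m / n)) n)

div≡/ : ∀ m n .{{_ : NonZero n}} → m div n ≡ m / n
div≡/ m (suc _) = refl

mod≡% : ∀ m n .{{_ : NonZero n}} → m mod n ≡ m % n
mod≡% m (suc _) = refl

n∸i≡1+[n∸1+i] : ∀ {n i} → i < n → n ∸ i ≡ suc (n ∸ suc i)
n∸i≡1+[n∸1+i] {n} {i} i<n = +-∸-assoc 1 {n} {suc i} i<n

n∸i≢0 : ∀ {n i} → i < n → NonZero (n ∸ i)
n∸i≢0 i<n rewrite n∸i≡1+[n∸1+i] i<n = _

ϖ≢0 : ∀ {n i} → i ≤ n → NonZero (ϖ n i)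
ϖ≢0 {i = zero}      _   = _
ϖ≢0 {n} {i = suc i} i<n = m*n≢0 (ϖ n i) (n ∸ i) {{ϖ≢0 (<⇒≤ i<n)}} {{n∸i≢0 i<n}}

ϖ*[n∸i]!≡n! : ∀ {n i} → i ≤ n → ϖ n i * (n ∸ i) ! ≡ n !
ϖ*[n∸i]!≡n! {n} {zero}  _   = *-identityˡ (n !)
ϖ*[n∸i]!≡n! {n} {suc i} i<n = begin
  ϖ n i * (n ∸ i) * (n ∸ suc i) !   ≡⟨ *-assoc (ϖ n i) (n ∸ i) _ ⟩
  ϖ n i * ((n ∸ i) * (n ∸ suc i) !) ≡⟨ cong (ϖ n i *_) [n∸i]*[n∸1+i]!≡[n∸i]! ⟩
  ϖ n i * (n ∸ i) !                 ≡⟨ ϖ*[n∸i]!≡n! (<⇒≤ i<n) ⟩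
  n !                               ∎
  where
  open ≡-Reasoning
  [n∸i]*[n∸1+i]!≡[n∸i]! : (n ∸ i) * (n ∸ suc i) ! ≡ (n ∸ i) !
  [n∸i]*[n∸1+i]!≡[n∸i]! rewrite n∸i≡1+[n∸1+i] i<n = refl

ϖ∣n! : ∀ {n i} → i ≤ n → ϖ n i ∣ n !
ϖ∣n! {n} {i} i≤n = divides ((n ∸ i) !) (trans (sym (ϖ*[n∸i]!≡n! i≤n)) (*-comm (ϖ n i) _))

digit≡n∸i∸1⇔ϖ[1+i]∣1+α : ∀ {n i} α → i < n → ϖ n i ∣ suc α →
                          digit n α i ≡ n ∸ i ∸ 1 ⇔ ϖ n (suc i) ∣ suc α
digit≡n∸i∸1⇔ϖ[1+i]∣1+α {n} {i} α i<n ϖ∣1+α =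
  subst (λ d → d ≡ n ∸ i ∸ 1 ⇔ ϖ n (suc i) ∣ suc α) (sym digit≡)
    ([m/n]%o≡o∸1⇔n*o∣1+m α (ϖ n i) (n ∸ i) ϖ∣1+α)
  where
  instance
    _ : NonZero (ϖ n i)
    _ = ϖ≢0 (<⇒≤ i<n)
    _ : NonZero (n ∸ i)
    _ = n∸i≢0 i<n
  digit≡ : digit n α i ≡ (α / ϖ n i) % (n ∸ i)
  digit≡ = trans (cong (_mod (n ∸ i)) (div≡/ α (ϖ n i))) (mod≡% (α / ϖ n i) (n ∸ i))

leading-cong : ∀ {n α γ} → (∀ {j} → j ≤ n → ϖ n j ∣ suc α ⇔ ϖ n j ∣ suc γ) →
               ∀ i m → i + m ≤ n → ϖ n i ∣ suc α → leading n α i m ≡ leading n γ i m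
leading-cong same i zero    _     _     = refl
leading-cong {n} {α} {γ} same i (suc m) i+m<n ϖ∣1+α = by-digits
  (digit≡n∸i∸1⇔ϖ[1+i]∣1+α α i<n ϖ∣1+α)
  (digit≡n∸i∸1⇔ϖ[1+i]∣1+α γ i<n (to (same (<⇒≤ i<n)) ϖ∣1+α))
  where
  i<n : i < n
  i<n = m+n≤o⇒m≤o (suc i) (subst (_≤ n) (+-suc i m) i+m<n)

  by-digits : digit n α i ≡ n ∸ i ∸ 1 ⇔ ϖ n (suc i) ∣ suc α →
              digit n γ i ≡ n ∸ i ∸ 1 ⇔ ϖ n (suc i) ∣ suc γ →
              leading n α i (suc m) ≡ leading n γ i (suc m)
  by-digits topα topγ with digit n α i ≟ n ∸ i ∸ 1 | digit n γ i ≟ n ∸ i ∸ 1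
  ... | yes α-top | yes _ = cong suc
        (leading-cong same (suc i) m (subst (_≤ n) (+-suc i m) i+m<n) (to topα α-top))
  ... | no _      | no _      = refl
  ... | yes α-top | no γ-low  = ⊥-elim (γ-low (from topγ (to (same i<n) (to topα α-top))))
  ... | no α-low  | yes γ-top = ⊥-elim (α-low (from topα (from (same i<n) (to topγ γ-top))))

1+α+1+[N∸2∸α]≡N : ∀ N α → 2 ≤ N → α ≤ N ∸ 2 → suc α + suc (N ∸ 2 ∸ α) ≡ N
1+α+1+[N∸2∸α]≡N (suc zero)    α (s≤s ()) _
1+α+1+[N∸2∸α]≡N (suc (suc K)) α _          α≤K =
  cong suc (trans (+-suc α (K ∸ α)) (cong suc (m+[n∸m]≡n α≤K)))

proposition15 : (n : ℕ) → 2 ≤ n → (α : ℕ) → α ≤ n ! ∸ 2 →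
    e n α ≡ e n (n ! ∸ 2 ∸ α)
proposition15 n 2≤n α α≤ = cong suc (leading-cong same 0 (n ∸ 2) (m∸n≤m n 2) (1∣ suc α))
  where
  2≤n! : 2 ≤ n !
  2≤n! = ∣⇒≤ {{n !≢0}} (m≤n⇒m!∣n! 2≤n)

  same : ∀ {j} → j ≤ n → ϖ n j ∣ suc α ⇔ ϖ n j ∣ suc (n ! ∸ 2 ∸ α)
  same {j} j≤n = ∣m+n⇒∣m⇔∣n
    (subst (ϖ n j ∣_) (sym (1+α+1+[N∸2∸α]≡N (n !) α 2≤n! α≤)) (ϖ∣n! j≤n))
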